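{- For $n\ge1$, $$\sum_{\sigma\in\mathfrak S_{n+1}}x^{{\rm des}(\sigma)}\Bigl(\frac12\Bigr)^{{\rm LRmin}(\sigma)+{\rm RLmin}(\sigma)-2}=\Bigl(\frac{1+x}{2}\Bigr)^n\sum_{\sigma\in\mathfrak S_n}\Bigl(\frac{4x}{(1+x)^2}\Bigr)^{{\rm L}(\sigma)}.$$
   Context: $\mathfrak S_m$ is the set of permutations $\sigma=\sigma_1\cdots\sigma_m$ of $[m]$. ${\rm des}(\sigma)$ = number of $1\le i<m$ with $\sigma_i>\sigma_{i+1}$; ${\rm L}(\sigma)$ = number of left peaks, i.e. $1\le i<m$ with $\sigma_{i-1}<\sigma_i>\sigma_{i+1}$ where $\sigma_0=0$; ${\rm LRmin}(\sigma)$ (resp. ${\rm RLmin}(\sigma)$) = number of entries smaller than all entries to their left (resp. right). The identity is one of rational functions in $x$. -}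

module Defs where

open import Data.Nat as ℕ using (ℕ; zero; suc; _<ᵇ_; _∸_)
open import Data.Bool using (Bool; true; false; if_then_else_; _∧_)
open import Data.List using (List; []; _∷_; map; concatMap; foldr; reverse)
open import Data.Rational as ℚ using (ℚ; 0ℚ; 1ℚ; ½; _+_; _*_; _÷_; ≢-nonZero)
open import Relation.Binary.PropositionalEquality using (_≢_)

-- Symmetric group S_m as the list of all permutations σ₁⋯σ_m (one-line notation)
-- of [m] = {1,…,m}.
insertions : ℕ → List ℕ → List (List ℕ)
insertions a []       = (a ∷ []) ∷ []
insertions a (b ∷ bs) = (a ∷ b ∷ bs) ∷ map (b ∷_) (insertions a bs)

perms : ℕ → List (List ℕ)
perms zero    = [] ∷ []
perms (suc m) = concatMap (insertions (suc m)) (perms m)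

b2n : Bool → ℕ
b2n true  = 1
b2n false = 0

des : List ℕ → ℕ
des []           = 0
des (a ∷ [])     = 0
des (a ∷ b ∷ bs) = b2n (b <ᵇ a) ℕ.+ des (b ∷ bs)

peaks : List ℕ → ℕ
peaks (a ∷ b ∷ c ∷ cs) = b2n ((a <ᵇ b) ∧ (c <ᵇ b)) ℕ.+ peaks (b ∷ c ∷ cs)
peaks _                = 0

leftPeaks : List ℕ → ℕ
leftPeaks σ = peaks (0 ∷ σ)

-- entries smaller than every entry to their left, given the current left minimum
-- (nothing = no entries yet)
lrminFrom : Bool → ℕ → List ℕ → ℕ
lrminFrom started m []       = 0
lrminFrom false   m (a ∷ as) = 1 ℕ.+ lrminFrom true a as
lrminFrom true    m (a ∷ as) =
  if a <ᵇ m then 1 ℕ.+ lrminFrom true a as else lrminFrom true m as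

LRmin : List ℕ → ℕ
LRmin σ = lrminFrom false 0 σ

RLmin : List ℕ → ℕ
RLmin σ = LRmin (reverse σ)

infixr 8 _^_
_^_ : ℚ → ℕ → ℚ
q ^ zero  = 1ℚ
q ^ suc k = q * (q ^ k)

sumℚ : List ℚ → ℚ
sumℚ = foldr _+_ 0ℚ

2ℚ 4ℚ : ℚ
2ℚ = 1ℚ + 1ℚ
4ℚ = 2ℚ + 2ℚ

lhs : ℕ → ℚ → ℚ
lhs n x = sumℚ (map (λ σ → (x ^ des σ) * (½ ^ ((LRmin σ ℕ.+ RLmin σ) ∸ 2))) (perms (suc n)))

ratio : (x : ℚ) → (1ℚ + x) ≢ 0ℚ → ℚ
ratio x h = ((4ℚ * x) ÷ (1ℚ + x)) {{≢-nonZero h}} ÷ (1ℚ + x)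
  where instance _ = ≢-nonZero h

rhs : ℕ → (x : ℚ) → (1ℚ + x) ≢ 0ℚ → ℚ
rhs n x h = (((1ℚ + x) * ½) ^ n) * sumℚ (map (λ σ → ratio x h ^ leftPeaks σ) (perms n))

module Submission where

-- Both sides are polynomials in x satisfying the same recursion in n.  Inserting
-- n + 1 into the n + 1 slots of σ ∈ S_n changes des σ and LRmin σ + RLmin σ in a
-- controlled way, which gives L_(n+1) = insertMax n L_n for the left-hand
-- polynomial, insertMax n being the linear map x^d ↦ (d + ½) x^d + (n - d - ½) x^(d+1).
-- On the right, σ with k left peaks contributes u^(n-2k) x^k with u = (1 + x)/2;
-- inserting n + 1 keeps k for 2k + 1 slots and raises it by one for the other
-- n - 2k, and a Leibniz rule for insertMax shows that the resulting sum is again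
-- insertMax n applied to u^(n-2k) x^k.  Since the recursion is an identity of
-- polynomials rather than of values at one x, polynomials are represented as
-- lists of monomials compared coefficientwise.

open import Defs
open import Function using (_∘_)
open import Data.Bool using (Bool; true; false; not; _∧_; _∨_; if_then_else_; T)
open import Data.Bool.Properties using (∧-zeroʳ)
open import Data.Nat as ℕ using (ℕ; zero; suc; pred; _∸_; _<_; _≤_; _≥_; _<ᵇ_; _≡ᵇ_; _⊔_; s≤s)
import Data.Nat.Properties as ℕₚ
open import Algebra.Properties.CommutativeSemigroup ℕₚ.+-commutativeSemigroup using (x∙yz≈y∙xz)
open import Data.Nat.Tactic.RingSolver using (solve-∀)
open import Data.Product using (_×_; _,_; proj₂; ∃-syntax)
open import Data.List using (List; []; _∷_; _++_; _∷ʳ_; [_]; map; concatMap; reverse; length; foldr)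
import Data.List.Properties as Listₚ
open import Data.List.Effectful using (module MonadProperties)
open import Data.List.Relation.Unary.All as All using (All; []; _∷_)
import Data.List.Relation.Unary.All.Properties as Allₚ
open import Data.Rational using (ℚ; 0ℚ; 1ℚ; ½; _+_; _*_; _-_; 1/_; ≢-nonZero)
import Data.Rational.Properties as ℚₚ
open import Data.Rational.Solver using (module +-*-Solver)
open import Relation.Nullary using (contradiction)
open import Relation.Binary.Bundles using (Setoid)
import Relation.Binary.Reasoning.Setoid as SetoidReasoning
open import Relation.Binary.PropositionalEquality hiding ([_])

open +-*-Solver

fromℕ : ℕ → ℚ
fromℕ zero    = 0ℚ
fromℕ (suc n) = 1ℚ + fromℕ n

fromℕ-+ : ∀ m n → fromℕ (m ℕ.+ n) ≡ fromℕ m + fromℕ n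
fromℕ-+ zero    n = sym (ℚₚ.+-identityˡ (fromℕ n))
fromℕ-+ (suc m) n = trans (cong (1ℚ +_) (fromℕ-+ m n)) (sym (ℚₚ.+-assoc 1ℚ (fromℕ m) (fromℕ n)))

-- A polynomial is an unnormalised list of monomials (coefficient , degree).
Monomial : Set
Monomial = ℚ × ℕ

Poly : Set
Poly = List Monomial

degree : Monomial → ℕ
degree = proj₂

coeffOf : ℕ → Monomial → ℚ
coeffOf i (c , d) = if d ≡ᵇ i then c else 0ℚ

coeff : Poly → ℕ → ℚ
coeff p i = sumℚ (map (coeffOf i) p)

eval : Poly → ℚ → ℚ
eval p x = sumℚ (map (λ (c , d) → x ^ d * c) p)

infix 4 _≈_
record _≈_ (p q : Poly) : Set where
  constructor mk≈
  field coeff-≡ : ∀ i → coeff p i ≡ coeff q i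
open _≈_

≈-refl : ∀ {p} → p ≈ p
≈-refl = mk≈ λ _ → refl

≈-reflexive : ∀ {p q} → p ≡ q → p ≈ q
≈-reflexive refl = ≈-refl

≈-sym : ∀ {p q} → p ≈ q → q ≈ p
≈-sym e = mk≈ λ i → sym (coeff-≡ e i)

≈-trans : ∀ {p q r} → p ≈ q → q ≈ r → p ≈ r
≈-trans e f = mk≈ λ i → trans (coeff-≡ e i) (coeff-≡ f i)

polySetoid : Setoid _ _
polySetoid = record
  { Carrier = Poly
  ; _≈_ = _≈_
  ; isEquivalence = record { refl = ≈-refl ; sym = ≈-sym ; trans = ≈-trans }
  }

module ≈-Reasoning = SetoidReasoning polySetoid

scale : ℚ → Poly → Poly
scale a = map (λ (c , d) → (a * c , d))

shift : Poly → Poly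
shift = map (λ (c , d) → (c , suc d))

bidiagonal : (ℕ → ℚ) → (ℕ → ℚ) → Poly → Poly
bidiagonal α γ = concatMap (λ (c , d) → (α d * c , d) ∷ (γ (suc d) * c , suc d) ∷ [])

u : ℚ → ℚ
u x = (1ℚ + x) * ½

mulU : Poly → Poly
mulU = bidiagonal (λ _ → ½) (λ _ → ½)

coeffOf-weight : ∀ (f : ℕ → ℚ) i c d → coeffOf i (f d * c , d) ≡ f i * coeffOf i (c , d)
coeffOf-weight f i c d with d ≡ᵇ i in eq
... | true  = cong (λ k → f k * c) (ℕₚ.≡ᵇ⇒≡ d i (subst T (sym eq) _))
... | false = sym (ℚₚ.*-zeroʳ (f i))

coeff-++ : ∀ p q i → coeff (p ++ q) i ≡ coeff p i + coeff q i
coeff-++ []      q i = sym (ℚₚ.+-identityˡ (coeff q i))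
coeff-++ (m ∷ p) q i = trans (cong (coeffOf i m +_) (coeff-++ p q i)) (sym (ℚₚ.+-assoc (coeffOf i m) _ _))

coeff-scale : ∀ a p i → coeff (scale a p) i ≡ a * coeff p i
coeff-scale a []            i = sym (ℚₚ.*-zeroʳ a)
coeff-scale a ((c , d) ∷ p) i =
  trans (cong₂ _+_ (coeffOf-weight (λ _ → a) i c d) (coeff-scale a p i)) (sym (ℚₚ.*-distribˡ-+ a _ _))

coeff-shift-zero : ∀ p → coeff (shift p) 0 ≡ 0ℚ
coeff-shift-zero []      = refl
coeff-shift-zero (m ∷ p) = trans (ℚₚ.+-identityˡ _) (coeff-shift-zero p)

coeff-shift-suc : ∀ p i → coeff (shift p) (suc i) ≡ coeff p i
coeff-shift-suc []      i = refl
coeff-shift-suc (m ∷ p) i = cong (coeffOf i m +_) (coeff-shift-suc p i)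

coeff-bidiagonal : ∀ α γ p i → coeff (bidiagonal α γ p) i ≡ α i * coeff p i + γ i * coeff (shift p) i
coeff-bidiagonal α γ []            i = sym (trans (cong₂ _+_ (ℚₚ.*-zeroʳ (α i)) (ℚₚ.*-zeroʳ (γ i))) (ℚₚ.+-identityˡ 0ℚ))
coeff-bidiagonal α γ ((c , d) ∷ p) i = begin
  coeffOf i (α d * c , d) + (coeffOf i (γ (suc d) * c , suc d) + coeff (bidiagonal α γ p) i)
    ≡⟨ cong₂ (λ y z → y + (z + coeff (bidiagonal α γ p) i)) (coeffOf-weight α i c d) (coeffOf-weight γ i c (suc d)) ⟩
  α i * e + (γ i * e′ + coeff (bidiagonal α γ p) i)
    ≡⟨ cong (λ z → α i * e + (γ i * e′ + z)) (coeff-bidiagonal α γ p i) ⟩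
  α i * e + (γ i * e′ + (α i * coeff p i + γ i * coeff (shift p) i))
    ≡⟨ solve 6 (λ a g e e′ c s → a :* e :+ (g :* e′ :+ (a :* c :+ g :* s)) := a :* (e :+ c) :+ g :* (e′ :+ s))
               refl (α i) (γ i) e e′ (coeff p i) (coeff (shift p) i) ⟩
  α i * (e + coeff p i) + γ i * (e′ + coeff (shift p) i) ∎
  where
  open ≡-Reasoning
  e  = coeffOf i (c , d)
  e′ = coeffOf i (c , suc d)

coeff-shift-bidiagonal : ∀ {α γ : ℕ → ℚ} (α′ γ′ : ℕ → ℚ) →
  (∀ i → α′ (suc i) ≡ α i) → (∀ i → γ′ (suc i) ≡ γ i) → ∀ p i →
  coeff (shift (bidiagonal α γ p)) i ≡ α′ i * coeff (shift p) i + γ′ i * coeff (shift (shift p)) i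
coeff-shift-bidiagonal {α} {γ} α′ γ′ _ _ p zero
  rewrite coeff-shift-zero (bidiagonal α γ p) | coeff-shift-zero p | coeff-shift-zero (shift p) =
  solve 2 (λ a g → con 0ℚ := a :* con 0ℚ :+ g :* con 0ℚ) refl (α′ 0) (γ′ 0)
coeff-shift-bidiagonal {α} {γ} α′ γ′ α′-suc γ′-suc p (suc i)
  rewrite coeff-shift-suc (bidiagonal α γ p) i | coeff-shift-suc p i | coeff-shift-suc (shift p) i
        | α′-suc i | γ′-suc i = coeff-bidiagonal α γ p i

++-cong : ∀ {p p′ q q′} → p ≈ p′ → q ≈ q′ → p ++ q ≈ p′ ++ q′
++-cong {p} {p′} {q} {q′} e f = mk≈ λ i →
  trans (coeff-++ p q i) (trans (cong₂ _+_ (coeff-≡ e i) (coeff-≡ f i)) (sym (coeff-++ p′ q′ i)))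

++-congˡ : ∀ r {p q} → p ≈ q → r ++ p ≈ r ++ q
++-congˡ r = ++-cong (≈-refl {r})

++-congʳ : ∀ r {p q} → p ≈ q → p ++ r ≈ q ++ r
++-congʳ r e = ++-cong e (≈-refl {r})

++-comm : ∀ p q → p ++ q ≈ q ++ p
++-comm p q = mk≈ λ i → trans (coeff-++ p q i) (trans (ℚₚ.+-comm (coeff p i) (coeff q i)) (sym (coeff-++ q p i)))

++-swap : ∀ p q r → p ++ (q ++ r) ≈ q ++ (p ++ r)
++-swap p q r = begin
  p ++ (q ++ r) ≡⟨ Listₚ.++-assoc p q r ⟨
  (p ++ q) ++ r ≈⟨ ++-congʳ r (++-comm p q) ⟩
  (q ++ p) ++ r ≡⟨ Listₚ.++-assoc q p r ⟩
  q ++ (p ++ r) ∎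
  where open ≈-Reasoning

shift-cong : ∀ {p q} → p ≈ q → shift p ≈ shift q
shift-cong {p} {q} e = mk≈ λ where
  zero    → trans (coeff-shift-zero p) (sym (coeff-shift-zero q))
  (suc i) → trans (coeff-shift-suc p i) (trans (coeff-≡ e i) (sym (coeff-shift-suc q i)))

bidiagonal-cong : ∀ α γ {p q} → p ≈ q → bidiagonal α γ p ≈ bidiagonal α γ q
bidiagonal-cong α γ {p} {q} e = mk≈ λ i → begin
  coeff (bidiagonal α γ p) i                ≡⟨ coeff-bidiagonal α γ p i ⟩
  α i * coeff p i + γ i * coeff (shift p) i ≡⟨ cong₂ (λ y z → α i * y + γ i * z) (coeff-≡ e i) (coeff-≡ (shift-cong e) i) ⟩
  α i * coeff q i + γ i * coeff (shift q) i ≡⟨ coeff-bidiagonal α γ q i ⟨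
  coeff (bidiagonal α γ q) i                ∎
  where open ≡-Reasoning

mulU-cong : ∀ {p q} → p ≈ q → mulU p ≈ mulU q
mulU-cong = bidiagonal-cong (λ _ → ½) (λ _ → ½)

coeff-mulU : ∀ p i → coeff (mulU p) i ≡ ½ * coeff p i + ½ * coeff (shift p) i
coeff-mulU = coeff-bidiagonal (λ _ → ½) (λ _ → ½)

scale-zero : ∀ p → scale 0ℚ p ≈ []
scale-zero p = mk≈ λ i → trans (coeff-scale 0ℚ p i) (ℚₚ.*-zeroˡ (coeff p i))

scale-suc : ∀ n p → p ++ scale (fromℕ n) p ≈ scale (fromℕ (suc n)) p
scale-suc n p = mk≈ λ i → begin
  coeff (p ++ scale (fromℕ n) p) i        ≡⟨ trans (coeff-++ p _ i) (cong (coeff p i +_) (coeff-scale (fromℕ n) p i)) ⟩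
  coeff p i + fromℕ n * coeff p i         ≡⟨ solve 2 (λ c m → c :+ m :* c := (con 1ℚ :+ m) :* c) refl (coeff p i) (fromℕ n) ⟩
  (1ℚ + fromℕ n) * coeff p i              ≡⟨ coeff-scale (fromℕ (suc n)) p i ⟨
  coeff (scale (fromℕ (suc n)) p) i       ∎
  where open ≡-Reasoning

concatMap-cong-≈ : ∀ {A : Set} {f g : A → Poly} xs → All (λ x → f x ≈ g x) xs → concatMap f xs ≈ concatMap g xs
concatMap-cong-≈ []       []       = ≈-refl
concatMap-cong-≈ (x ∷ xs) (e ∷ es) = ++-cong e (concatMap-cong-≈ xs es)

-- Horner's scheme p = p(0) + x · quotX p; eval-cong follows by induction on a degree bound.
quotX : Poly → Poly
quotX = concatMap λ where
  (c , zero)  → []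
  (c , suc d) → (c , d) ∷ []

coeff-quotX : ∀ p i → coeff (quotX p) i ≡ coeff p (suc i)
coeff-quotX []                i = refl
coeff-quotX ((c , zero)  ∷ p) i = trans (coeff-quotX p i) (sym (ℚₚ.+-identityˡ _))
coeff-quotX ((c , suc d) ∷ p) i = cong (coeffOf i (c , d) +_) (coeff-quotX p i)

quotX-cong : ∀ {p q} → p ≈ q → quotX p ≈ quotX q
quotX-cong {p} {q} e = mk≈ λ i → trans (coeff-quotX p i) (trans (coeff-≡ e (suc i)) (sym (coeff-quotX q i)))

eval-horner : ∀ p x → eval p x ≡ coeff p 0 + x * eval (quotX p) x
eval-horner []                x = sym (trans (ℚₚ.+-identityˡ _) (ℚₚ.*-zeroʳ x))
eval-horner ((c , zero)  ∷ p) x rewrite eval-horner p x =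
  solve 4 (λ c k x e → con 1ℚ :* c :+ (k :+ x :* e) := (c :+ k) :+ x :* e) refl c (coeff p 0) x (eval (quotX p) x)
eval-horner ((c , suc d) ∷ p) x rewrite eval-horner p x =
  solve 5 (λ y c k x e → x :* y :* c :+ (k :+ x :* e) := (con 0ℚ :+ k) :+ x :* (y :* c :+ e))
    refl (x ^ d) c (coeff p 0) x (eval (quotX p) x)

quotX-below : ∀ B p → All (λ m → degree m < suc B) p → All (λ m → degree m < B) (quotX p)
quotX-below B []                []           = []
quotX-below B ((c , zero)  ∷ p) (_     ∷ bs) = quotX-below B p bs
quotX-below B ((c , suc d) ∷ p) (s≤s b ∷ bs) = b ∷ quotX-below B p bs

eval-cong-below : ∀ B {p q} → All (λ m → degree m < B) (p ++ q) → p ≈ q → ∀ x → eval p x ≡ eval q x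
eval-cong-below zero    {[]}    {[]}    _        _ x = refl
eval-cong-below zero    {[]}    {_ ∷ _} (() ∷ _) _ x
eval-cong-below zero    {_ ∷ _}         (() ∷ _) _ x
eval-cong-below (suc B) {p}     {q}     below    e x = begin
  eval p x                            ≡⟨ eval-horner p x ⟩
  coeff p 0 + x * eval (quotX p) x    ≡⟨ cong₂ (λ y z → y + x * z) (coeff-≡ e 0)
                                             (eval-cong-below B below′ (quotX-cong e) x) ⟩
  coeff q 0 + x * eval (quotX q) x    ≡⟨ eval-horner q x ⟨
  eval q x                            ∎
  where
  open ≡-Reasoning
  below′ : All (λ m → degree m < B) (quotX p ++ quotX q)
  below′ = subst (All _) (Listₚ.concatMap-++ _ p q) (quotX-below B (p ++ q) below)

maxDegree : Poly → ℕ
maxDegree = foldr (λ m b → degree m ⊔ b) 0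

degree≤maxDegree : ∀ p → All (λ m → degree m ≤ maxDegree p) p
degree≤maxDegree []            = []
degree≤maxDegree ((c , d) ∷ p) =
  ℕₚ.m≤m⊔n d (maxDegree p) ∷ All.map (λ b → ℕₚ.≤-trans b (ℕₚ.m≤n⊔m d (maxDegree p))) (degree≤maxDegree p)

eval-cong : ∀ {p q} → p ≈ q → ∀ x → eval p x ≡ eval q x
eval-cong {p} {q} = eval-cong-below (suc (maxDegree (p ++ q))) (All.map s≤s (degree≤maxDegree (p ++ q)))

eval-++ : ∀ p q x → eval (p ++ q) x ≡ eval p x + eval q x
eval-++ []      q x = sym (ℚₚ.+-identityˡ _)
eval-++ ((c , d) ∷ p) q x = trans (cong (x ^ d * c +_) (eval-++ p q x)) (sym (ℚₚ.+-assoc (x ^ d * c) _ _))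

eval-concatMap : ∀ {A : Set} (f : A → Poly) xs x → eval (concatMap f xs) x ≡ sumℚ (map (λ a → eval (f a) x) xs)
eval-concatMap f []       x = refl
eval-concatMap f (a ∷ xs) x = trans (eval-++ (f a) _ x) (cong (eval (f a) x +_) (eval-concatMap f xs x))

eval-mulU : ∀ p x → eval (mulU p) x ≡ u x * eval p x
eval-mulU []            x = sym (ℚₚ.*-zeroʳ (u x))
eval-mulU ((c , d) ∷ p) x rewrite eval-mulU p x =
  solve 4 (λ y c x e → y :* (con ½ :* c) :+ (x :* y :* (con ½ :* c) :+ (con 1ℚ :+ x) :* con ½ :* e)
                     := (con 1ℚ :+ x) :* con ½ :* (y :* c :+ e))
    refl (x ^ d) c x (eval p x)

insertMax : ℕ → Poly → Poly
insertMax n = bidiagonal (λ d → fromℕ d + ½) (λ d → fromℕ n - fromℕ d + ½)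

insertMax-cong : ∀ n {p q} → p ≈ q → insertMax n p ≈ insertMax n q
insertMax-cong n = bidiagonal-cong (λ d → fromℕ d + ½) (λ d → fromℕ n - fromℕ d + ½)

mulU-++ : ∀ p q → mulU (p ++ q) ≡ mulU p ++ mulU q
mulU-++ = Listₚ.concatMap-++ _

shift-mulU : ∀ p → shift (mulU p) ≡ mulU (shift p)
shift-mulU p = trans (Listₚ.map-concatMap _ _ p) (sym (Listₚ.concatMap-map _ _ p))

mulU-scale : ∀ a p → mulU (scale a p) ≡ scale a (mulU p)
mulU-scale a p = begin
  mulU (scale a p)                                       ≡⟨ Listₚ.concatMap-map _ _ p ⟩
  concatMap (λ (c , d) → (½ * (a * c) , d) ∷ (½ * (a * c) , suc d) ∷ []) p
    ≡⟨ Listₚ.concatMap-cong (λ (c , d) → cong (λ y → (y , d) ∷ (y , suc d) ∷ []) (½-comm c)) p ⟩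
  concatMap (λ (c , d) → (a * (½ * c) , d) ∷ (a * (½ * c) , suc d) ∷ []) p
                                                         ≡⟨ Listₚ.map-concatMap _ _ p ⟨
  scale a (mulU p)                                       ∎
  where
  open ≡-Reasoning
  ½-comm : ∀ c → ½ * (a * c) ≡ a * (½ * c)
  ½-comm = solve 2 (λ a c → con ½ :* (a :* c) := a :* (con ½ :* c)) refl a

-- insertMax n f = ½ f + (n - ½) x f + x (1 - x) f′, so with u′ = ½ it obeys a Leibniz rule.
insertMax-mulU : ∀ N p → insertMax (suc N) (mulU p) ≈ shift p ++ mulU (insertMax N p)
insertMax-mulU N p = mk≈ coeff-eq
  where
  open ≡-Reasoning
  α α′ : ℕ → ℚ
  α  j = fromℕ j + ½
  α′ j = fromℕ j - ½
  γ : ℕ → ℕ → ℚ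
  γ n j = fromℕ n - fromℕ j + ½
  α′-suc : ∀ j → α′ (suc j) ≡ α j
  α′-suc j = solve 1 (λ j → (con 1ℚ :+ j) :- con ½ := j :+ con ½) refl (fromℕ j)
  γ-suc : ∀ j → γ (suc N) (suc j) ≡ γ N j
  γ-suc j = solve 2 (λ n j → (con 1ℚ :+ n) :- (con 1ℚ :+ j) :+ con ½ := n :- j :+ con ½) refl (fromℕ N) (fromℕ j)

  coeff-eq : ∀ i → coeff (insertMax (suc N) (mulU p)) i ≡ coeff (shift p ++ mulU (insertMax N p)) i
  coeff-eq i = begin
    coeff (insertMax (suc N) (mulU p)) i
      ≡⟨ coeff-bidiagonal α (γ (suc N)) (mulU p) i ⟩
    α i * coeff (mulU p) i + γ (suc N) i * coeff (shift (mulU p)) i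
      ≡⟨ cong₂ (λ y z → α i * y + γ (suc N) i * z) (coeff-mulU p i)
               (coeff-shift-bidiagonal (λ _ → ½) (λ _ → ½) (λ _ → refl) (λ _ → refl) p i) ⟩
    α i * (½ * c + ½ * s) + γ (suc N) i * (½ * s + ½ * s′)
      ≡⟨ solve 5 (λ n j c s s′ → (j :+ con ½) :* (con ½ :* c :+ con ½ :* s)
                                   :+ ((con 1ℚ :+ n) :- j :+ con ½) :* (con ½ :* s :+ con ½ :* s′)
                                := s :+ (con ½ :* ((j :+ con ½) :* c :+ (n :- j :+ con ½) :* s)
                                         :+ con ½ :* ((j :- con ½) :* s :+ ((con 1ℚ :+ n) :- j :+ con ½) :* s′)))
                 refl (fromℕ N) (fromℕ i) c s s′ ⟩
    s + (½ * (α i * c + γ N i * s) + ½ * (α′ i * s + γ (suc N) i * s′))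
      ≡⟨ cong₂ (λ y z → s + (½ * y + ½ * z)) (coeff-bidiagonal α (γ N) p i)
               (coeff-shift-bidiagonal α′ (γ (suc N)) α′-suc γ-suc p i) ⟨
    s + (½ * coeff (insertMax N p) i + ½ * coeff (shift (insertMax N p)) i)
      ≡⟨ cong (s +_) (coeff-mulU (insertMax N p) i) ⟨
    coeff (shift p) i + coeff (mulU (insertMax N p)) i
      ≡⟨ coeff-++ (shift p) _ i ⟨
    coeff (shift p ++ mulU (insertMax N p)) i ∎
    where
    c  = coeff p i
    s  = coeff (shift p) i
    s′ = coeff (shift (shift p)) i

uxPow : ℕ → ℕ → Poly
uxPow zero    k = [ (1ℚ , k) ]
uxPow (suc j) k = mulU (uxPow j k)

eval-uxPow : ∀ j k x → eval (uxPow j k) x ≡ u x ^ j * x ^ k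
eval-uxPow zero    k x = trans (ℚₚ.+-identityʳ _) (trans (ℚₚ.*-identityʳ (x ^ k)) (sym (ℚₚ.*-identityˡ (x ^ k))))
eval-uxPow (suc j) k x = trans (eval-mulU (uxPow j k) x) (trans (cong (u x *_) (eval-uxPow j k x)) (sym (ℚₚ.*-assoc (u x) _ _)))

shift-uxPow : ∀ j k → shift (uxPow j k) ≡ uxPow j (suc k)
shift-uxPow zero    k = refl
shift-uxPow (suc j) k = trans (shift-mulU (uxPow j k)) (cong mulU (shift-uxPow j k))

-- In a permutation of size j + 2k with k left peaks, 2k + 1 insertion slots keep
-- the number of left peaks and j slots raise it.
insertMax-uxPow : ∀ j k → insertMax (suc (j ℕ.+ (k ℕ.+ k))) (uxPow j k)
                        ≈ scale (fromℕ (suc (k ℕ.+ k))) (uxPow (suc j) k) ++ scale (fromℕ j) (uxPow (pred j) (suc k))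
insertMax-uxPow zero k = begin
  (first , k) ∷ (second , suc k) ∷ []
    ≡⟨ cong₂ (λ y z → (y , k) ∷ (z , suc k) ∷ []) first≡ second≡ ⟩
  scale (fromℕ (suc (k ℕ.+ k))) (uxPow 1 k)
    ≈⟨ ++-congˡ (scale (fromℕ (suc (k ℕ.+ k))) (uxPow 1 k)) (scale-zero (uxPow 0 (suc k))) ⟨
  scale (fromℕ (suc (k ℕ.+ k))) (uxPow 1 k) ++ scale 0ℚ (uxPow 0 (suc k)) ∎
  where
  open ≈-Reasoning
  first second : ℚ
  first  = (fromℕ k + ½) * 1ℚ
  second = (fromℕ (suc (k ℕ.+ k)) - fromℕ (suc k) + ½) * 1ℚ
  first≡ : first ≡ fromℕ (suc (k ℕ.+ k)) * (½ * 1ℚ)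
  first≡ rewrite fromℕ-+ k k =
    solve 1 (λ k → (k :+ con ½) :* con 1ℚ := (con 1ℚ :+ (k :+ k)) :* (con ½ :* con 1ℚ)) refl (fromℕ k)
  second≡ : second ≡ fromℕ (suc (k ℕ.+ k)) * (½ * 1ℚ)
  second≡ rewrite fromℕ-+ k k =
    solve 1 (λ k → ((con 1ℚ :+ (k :+ k)) :- (con 1ℚ :+ k) :+ con ½) :* con 1ℚ := (con 1ℚ :+ (k :+ k)) :* (con ½ :* con 1ℚ))
      refl (fromℕ k)
insertMax-uxPow (suc j) k = begin
  insertMax (suc (suc j ℕ.+ (k ℕ.+ k))) (mulU (uxPow j k))
    ≈⟨ insertMax-mulU (suc (j ℕ.+ (k ℕ.+ k))) (uxPow j k) ⟩
  shift (uxPow j k) ++ mulU (insertMax (suc (j ℕ.+ (k ℕ.+ k))) (uxPow j k))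
    ≈⟨ ++-cong (≈-reflexive (shift-uxPow j k)) (mulU-cong (insertMax-uxPow j k)) ⟩
  uxPow j (suc k) ++ mulU (scale c (uxPow (suc j) k) ++ scale (fromℕ j) (uxPow (pred j) (suc k)))
    ≡⟨ cong (uxPow j (suc k) ++_) (trans (mulU-++ (scale c (uxPow (suc j) k)) _)
                                        (cong₂ _++_ (mulU-scale c (uxPow (suc j) k)) (mulU-scale (fromℕ j) (uxPow (pred j) (suc k))))) ⟩
  uxPow j (suc k) ++ (scale c (uxPow (suc (suc j)) k) ++ scale (fromℕ j) (mulU (uxPow (pred j) (suc k))))
    ≈⟨ ++-swap (uxPow j (suc k)) (scale c (uxPow (suc (suc j)) k)) _ ⟩
  scale c (uxPow (suc (suc j)) k) ++ (uxPow j (suc k) ++ scale (fromℕ j) (mulU (uxPow (pred j) (suc k))))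
    ≈⟨ ++-congˡ (scale c (uxPow (suc (suc j)) k)) (tail j) ⟩
  scale c (uxPow (suc (suc j)) k) ++ scale (fromℕ (suc j)) (uxPow j (suc k)) ∎
  where
  open ≈-Reasoning
  c = fromℕ (suc (k ℕ.+ k))
  tail : ∀ j → uxPow j (suc k) ++ scale (fromℕ j) (mulU (uxPow (pred j) (suc k))) ≈ scale (fromℕ (suc j)) (uxPow j (suc k))
  tail zero    = ≈-trans (++-congˡ (uxPow 0 (suc k)) (≈-trans (scale-zero (uxPow 1 (suc k))) (≈-sym (scale-zero (uxPow 0 (suc k))))))
                         (scale-suc 0 (uxPow 0 (suc k)))
  tail (suc j) = scale-suc (suc j) (uxPow (suc j) (suc k))

trues : List Bool → ℕ
trues []       = 0
trues (g ∷ gs) = b2n g ℕ.+ trues gs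

falses : List Bool → ℕ
falses = trues ∘ map not

trues+falses≡length : ∀ gs → trues gs ℕ.+ falses gs ≡ length gs
trues+falses≡length []           = refl
trues+falses≡length (true  ∷ gs) = cong suc (trues+falses≡length gs)
trues+falses≡length (false ∷ gs) = trans (ℕₚ.+-suc (trues gs) (falses gs)) (cong suc (trues+falses≡length gs))

concatMap-flags : ∀ (F : ℕ → Poly) K gs →
  concatMap (λ g → F (b2n (not g) ℕ.+ K)) gs ≈ scale (fromℕ (trues gs)) (F K) ++ scale (fromℕ (falses gs)) (F (suc K))
concatMap-flags F K [] = ≈-sym (++-cong (scale-zero (F K)) (scale-zero (F (suc K))))
concatMap-flags F K (true ∷ gs) = begin
  F K ++ concatMap (λ g → F (b2n (not g) ℕ.+ K)) gs ≈⟨ ++-congˡ (F K) (concatMap-flags F K gs) ⟩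
  F K ++ (scale t (F K) ++ scale f (F (suc K)))       ≡⟨ Listₚ.++-assoc (F K) _ _ ⟨
  (F K ++ scale t (F K)) ++ scale f (F (suc K))       ≈⟨ ++-congʳ (scale f (F (suc K))) (scale-suc (trues gs) (F K)) ⟩
  scale (1ℚ + t) (F K) ++ scale f (F (suc K))         ∎
  where
  open ≈-Reasoning
  t = fromℕ (trues gs)
  f = fromℕ (falses gs)
concatMap-flags F K (false ∷ gs) = begin
  F (suc K) ++ concatMap (λ g → F (b2n (not g) ℕ.+ K)) gs ≈⟨ ++-congˡ (F (suc K)) (concatMap-flags F K gs) ⟩
  F (suc K) ++ (scale t (F K) ++ scale f (F (suc K)))       ≈⟨ ++-swap (F (suc K)) (scale t (F K)) _ ⟩
  scale t (F K) ++ (F (suc K) ++ scale f (F (suc K)))       ≈⟨ ++-congˡ (scale t (F K)) (scale-suc (falses gs) (F (suc K))) ⟩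
  scale t (F K) ++ scale (1ℚ + f) (F (suc K))               ∎
  where
  open ≈-Reasoning
  t = fromℕ (trues gs)
  f = fromℕ (falses gs)

Flagged : (List ℕ → ℕ) → List (List ℕ) → ℕ → List Bool → Set
Flagged stat τs K gs = map stat τs ≡ map (λ g → b2n (not g) ℕ.+ K) gs

raise-Flagged : ∀ δ {stat τs K gs} → Flagged stat τs K gs → Flagged (λ τ → δ ℕ.+ stat τ) τs (δ ℕ.+ K) gs
raise-Flagged δ {stat} {τs} {K} {gs} flagged = begin
  map (λ τ → δ ℕ.+ stat τ) τs                        ≡⟨ Listₚ.map-∘ τs ⟩
  map (δ ℕ.+_) (map stat τs)                         ≡⟨ cong (map (δ ℕ.+_)) flagged ⟩
  map (δ ℕ.+_) (map (λ g → b2n (not g) ℕ.+ K) gs)    ≡⟨ Listₚ.map-∘ gs ⟨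
  map (λ g → δ ℕ.+ (b2n (not g) ℕ.+ K)) gs           ≡⟨ Listₚ.map-cong (λ g → x∙yz≈y∙xz δ (b2n (not g)) K) gs ⟩
  map (λ g → b2n (not g) ℕ.+ (δ ℕ.+ K)) gs           ∎
  where open ≡-Reasoning

concatMap-Flagged : ∀ (F : ℕ → Poly) {stat τs K gs} → Flagged stat τs K gs →
  concatMap (F ∘ stat) τs ≈ scale (fromℕ (trues gs)) (F K) ++ scale (fromℕ (falses gs)) (F (suc K))
concatMap-Flagged F {stat} {τs} {K} {gs} flagged = begin
  concatMap (F ∘ stat) τs                               ≡⟨ Listₚ.concatMap-map F stat τs ⟨
  concatMap F (map stat τs)                             ≡⟨ cong (concatMap F) flagged ⟩
  concatMap F (map (λ g → b2n (not g) ℕ.+ K) gs)        ≡⟨ Listₚ.concatMap-map F _ gs ⟩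
  concatMap (λ g → F (b2n (not g) ℕ.+ K)) gs            ≈⟨ concatMap-flags F K gs ⟩
  scale (fromℕ (trues gs)) (F K) ++ scale (fromℕ (falses gs)) (F (suc K)) ∎
  where open ≈-Reasoning

<ᵇ-true : ∀ {m n} → m < n → (m <ᵇ n) ≡ true
<ᵇ-true {m} {n} m<n with m <ᵇ n | ℕₚ.<⇒<ᵇ m<n
... | true | _ = refl

<ᵇ-false : ∀ {m n} → n ≤ m → (m <ᵇ n) ≡ false
<ᵇ-false {m} {n} n≤m with m <ᵇ n in eq
... | false = refl
... | true  = contradiction (ℕₚ.<ᵇ⇒< m n (subst T (sym eq) _)) (ℕₚ.≤⇒≯ n≤m)

b2n-not-+ : ∀ g n → b2n (not g) ℕ.+ (b2n g ℕ.+ n) ≡ suc n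
b2n-not-+ true  n = refl
b2n-not-+ false n = refl

All-reverse : ∀ {P : ℕ → Set} {xs} → All P xs → All P (reverse xs)
All-reverse {xs = []}     []         = []
All-reverse {xs = x ∷ xs} (px ∷ pxs) =
  subst (All _) (sym (Listₚ.unfold-reverse x xs)) (Allₚ.++⁺ (All-reverse pxs) (px ∷ []))

insertsBefore : ℕ → List ℕ → List (List ℕ)
insertsBefore a []       = []
insertsBefore a (c ∷ cs) = (a ∷ c ∷ cs) ∷ map (c ∷_) (insertsBefore a cs)

insertions-∷ʳ : ∀ a σ → insertions a σ ≡ insertsBefore a σ ∷ʳ (σ ∷ʳ a)
insertions-∷ʳ a []       = refl
insertions-∷ʳ a (c ∷ cs) = cong ((a ∷ c ∷ cs) ∷_)
  (trans (cong (map (c ∷_)) (insertions-∷ʳ a cs)) (Listₚ.map-++ (c ∷_) (insertsBefore a cs) _))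

InsertedBefore : ℕ → List ℕ → List ℕ → Set
InsertedBefore a σ τ = ∃[ u ] ∃[ c ] ∃[ v ] (τ ≡ u ++ a ∷ c ∷ v × σ ≡ u ++ c ∷ v)

insertsBefore-shape : ∀ a σ → All (InsertedBefore a σ) (insertsBefore a σ)
insertsBefore-shape a []       = []
insertsBefore-shape a (c ∷ cs) = ([] , c , cs , refl , refl)
  ∷ Allₚ.map⁺ (All.map (λ (u , c′ , v , τ≡ , cs≡) → c ∷ u , c′ , v , cong (c ∷_) τ≡ , cong (c ∷_) cs≡)
                        (insertsBefore-shape a cs))

insertions-length : ∀ a σ → All (λ τ → length τ ≡ suc (length σ)) (insertions a σ)
insertions-length a []       = refl ∷ []
insertions-length a (b ∷ bs) = refl ∷ Allₚ.map⁺ (All.map (cong suc) (insertions-length a bs))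

insertions-All : ∀ {P : ℕ → Set} a σ → P a → All P σ → All (All P) (insertions a σ)
insertions-All a []       pa []         = (pa ∷ []) ∷ []
insertions-All a (b ∷ bs) pa (pb ∷ pbs) = (pa ∷ pb ∷ pbs) ∷ Allₚ.map⁺ (All.map (pb ∷_) (insertions-All a bs pa pbs))

perms-length : ∀ m → All (λ σ → length σ ≡ m) (perms m)
perms-length zero    = refl ∷ []
perms-length (suc m) = Allₚ.concat⁺ (Allₚ.map⁺
  (All.map (λ {σ} len → All.map (λ len′ → trans len′ (cong suc len)) (insertions-length (suc m) σ)) (perms-length m)))

perms-below : ∀ m → All (All (_< suc m)) (perms m)
perms-below zero    = [] ∷ []
perms-below (suc m) = Allₚ.concat⁺ (Allₚ.map⁺
  (All.map (λ {σ} below → insertions-All (suc m) σ ℕₚ.≤-refl (All.map ℕₚ.m≤n⇒m≤1+n below)) (perms-below m)))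

lrminFrom-skip : ∀ {a m} u v → m < a → All (_< a) u → lrminFrom true m (u ++ a ∷ v) ≡ lrminFrom true m (u ++ v)
lrminFrom-skip {a} {m} []      v m<a _ rewrite <ᵇ-false {a} {m} (ℕₚ.<⇒≤ m<a) = refl
lrminFrom-skip {a} {m} (c ∷ u) v m<a (c<a ∷ u<a) with c <ᵇ m
... | true  = cong suc (lrminFrom-skip u v c<a u<a)
... | false = lrminFrom-skip u v m<a u<a

LRmin-insert : ∀ {a} b u v → All (_< a) (b ∷ u) → LRmin ((b ∷ u) ++ a ∷ v) ≡ LRmin ((b ∷ u) ++ v)
LRmin-insert b u v (b<a ∷ u<a) = cong suc (lrminFrom-skip u v b<a u<a)

LRmin-front : ∀ {a} σ → All (_< a) σ → LRmin (a ∷ σ) ≡ suc (LRmin σ)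
LRmin-front     []       []        = refl
LRmin-front {a} (c ∷ cs) (c<a ∷ _) rewrite <ᵇ-true c<a = refl

∷ʳ-as-∷ : ∀ (w : List ℕ) c → ∃[ b ] ∃[ w′ ] (w ∷ʳ c ≡ b ∷ w′)
∷ʳ-as-∷ []      c = c , [] , refl
∷ʳ-as-∷ (b ∷ w) c = b , w ∷ʳ c , refl

reverse-insert : ∀ (u : List ℕ) a w → reverse (u ++ a ∷ w) ≡ reverse w ++ a ∷ reverse u
reverse-insert u a w = begin
  reverse (u ++ a ∷ w)          ≡⟨ Listₚ.reverse-++ u (a ∷ w) ⟩
  reverse (a ∷ w) ++ reverse u  ≡⟨ cong (_++ reverse u) (Listₚ.unfold-reverse a w) ⟩
  (reverse w ∷ʳ a) ++ reverse u ≡⟨ Listₚ.++-assoc (reverse w) [ a ] (reverse u) ⟩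
  reverse w ++ a ∷ reverse u    ∎
  where open ≡-Reasoning

RLmin-insert : ∀ {a} u c v → All (_< a) (u ++ c ∷ v) → RLmin (u ++ a ∷ c ∷ v) ≡ RLmin (u ++ c ∷ v)
RLmin-insert {a} u c v below with ∷ʳ-as-∷ (reverse v) c
... | b , w , rev≡ = begin
  LRmin (reverse (u ++ a ∷ c ∷ v))          ≡⟨ cong LRmin (reverse-insert u a (c ∷ v)) ⟩
  LRmin (reverse (c ∷ v) ++ a ∷ reverse u)  ≡⟨ cong (λ z → LRmin (z ++ a ∷ reverse u)) rev-c∷v ⟩
  LRmin ((b ∷ w) ++ a ∷ reverse u)          ≡⟨ LRmin-insert b w (reverse u) b∷w-below ⟩
  LRmin ((b ∷ w) ++ reverse u)              ≡⟨ cong (λ z → LRmin (z ++ reverse u)) rev-c∷v ⟨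
  LRmin (reverse (c ∷ v) ++ reverse u)      ≡⟨ cong LRmin (Listₚ.reverse-++ u (c ∷ v)) ⟨
  LRmin (reverse (u ++ c ∷ v))              ∎
  where
  open ≡-Reasoning
  rev-c∷v : reverse (c ∷ v) ≡ b ∷ w
  rev-c∷v = trans (Listₚ.unfold-reverse c v) rev≡
  b∷w-below : All (_< a) (b ∷ w)
  b∷w-below = subst (All (_< a)) rev-c∷v
    (Allₚ.++⁻ˡ (reverse (c ∷ v)) (subst (All (_< a)) (Listₚ.reverse-++ u (c ∷ v)) (All-reverse below)))

RLmin-∷ʳ : ∀ {a} σ → All (_< a) σ → RLmin (σ ∷ʳ a) ≡ suc (RLmin σ)
RLmin-∷ʳ σ below = trans (cong LRmin (Listₚ.reverse-++ σ [ _ ])) (LRmin-front (reverse σ) (All-reverse below))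

RLmin-∷ : ∀ b bs → ∃[ r ] (RLmin (b ∷ bs) ≡ suc r)
RLmin-∷ b bs with ∷ʳ-as-∷ (reverse bs) b
... | b′ , w , rev≡ = _ , cong LRmin (trans (Listₚ.unfold-reverse b bs) rev≡)

minimaExcess : List ℕ → ℕ
minimaExcess τ = (LRmin τ ℕ.+ RLmin τ) ∸ 2

minimaExcess-≡ : ∀ τ {l r} → LRmin τ ≡ suc l → RLmin τ ≡ suc r → minimaExcess τ ≡ l ℕ.+ r
minimaExcess-≡ τ {l} {r} L≡ R≡ rewrite L≡ | R≡ = cong (_∸ 1) (ℕₚ.+-suc l r)

minimaExcess-front : ∀ {a} b bs → All (_< a) (b ∷ bs) → minimaExcess (a ∷ b ∷ bs) ≡ suc (minimaExcess (b ∷ bs))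
minimaExcess-front {a} b bs below with RLmin-∷ b bs
... | r , R≡ = trans (minimaExcess-≡ (a ∷ b ∷ bs) (LRmin-front (b ∷ bs) below) (trans (RLmin-insert [] b bs below) R≡))
                     (cong suc (sym (minimaExcess-≡ (b ∷ bs) refl R≡)))

minimaExcess-∷ʳ : ∀ {a} b bs → All (_< a) (b ∷ bs) → minimaExcess (b ∷ bs ∷ʳ a) ≡ suc (minimaExcess (b ∷ bs))
minimaExcess-∷ʳ {a} b bs below with RLmin-∷ b bs
... | r , R≡ = begin
  minimaExcess (b ∷ bs ∷ʳ a) ≡⟨ minimaExcess-≡ (b ∷ bs ∷ʳ a) L≡ (trans (RLmin-∷ʳ (b ∷ bs) below) (cong suc R≡)) ⟩
  l ℕ.+ suc r                ≡⟨ ℕₚ.+-suc l r ⟩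
  suc (l ℕ.+ r)              ≡⟨ cong suc (minimaExcess-≡ (b ∷ bs) refl R≡) ⟨
  suc (minimaExcess (b ∷ bs)) ∎
  where
  open ≡-Reasoning
  l = lrminFrom true b bs
  L≡ : LRmin (b ∷ bs ∷ʳ a) ≡ suc l
  L≡ = trans (LRmin-insert b bs [] below) (cong LRmin (Listₚ.++-identityʳ (b ∷ bs)))

minimaExcess-insertsBefore : ∀ {a} b bs → All (_< a) (b ∷ bs) →
  All (λ τ → minimaExcess (b ∷ τ) ≡ minimaExcess (b ∷ bs)) (insertsBefore a bs)
minimaExcess-insertsBefore {a} b bs below = All.map invariant (insertsBefore-shape a bs)
  where
  invariant : ∀ {τ} → InsertedBefore a bs τ → minimaExcess (b ∷ τ) ≡ minimaExcess (b ∷ bs)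
  invariant (u , c , v , refl , refl) = cong₂ (λ L R → (L ℕ.+ R) ∸ 2)
    (LRmin-insert b u (c ∷ v) (Allₚ.++⁻ˡ (b ∷ u) below)) (RLmin-insert (b ∷ u) c v below)

descentFlags : ℕ → List ℕ → List Bool
descentFlags b []       = []
descentFlags b (c ∷ cs) = (c <ᵇ b) ∷ descentFlags c cs

trues-descentFlags : ∀ b bs → trues (descentFlags b bs) ≡ des (b ∷ bs)
trues-descentFlags b []       = refl
trues-descentFlags b (c ∷ cs) = cong (b2n (c <ᵇ b) ℕ.+_) (trues-descentFlags c cs)

length-descentFlags : ∀ b bs → length (descentFlags b bs) ≡ length bs
length-descentFlags b []       = refl
length-descentFlags b (c ∷ cs) = cong suc (length-descentFlags c cs)

des-insertsBefore : ∀ {a} b bs → All (_< a) (b ∷ bs) →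
  Flagged (λ τ → des (b ∷ τ)) (insertsBefore a bs) (des (b ∷ bs)) (descentFlags b bs)
des-insertsBefore     b []       _                   = refl
des-insertsBefore {a} b (c ∷ cs) (b<a ∷ c<a ∷ below) = cong₂ _∷_ front
  (trans (sym (Listₚ.map-∘ (insertsBefore a cs))) (raise-Flagged (b2n (c <ᵇ b)) (des-insertsBefore c cs (c<a ∷ below))))
  where
  front : des (b ∷ a ∷ c ∷ cs) ≡ b2n (not (c <ᵇ b)) ℕ.+ des (b ∷ c ∷ cs)
  front rewrite <ᵇ-false {a} {b} (ℕₚ.<⇒≤ b<a) | <ᵇ-true c<a = sym (b2n-not-+ (c <ᵇ b) (des (c ∷ cs)))

des-front : ∀ {a} b bs → b < a → des (a ∷ b ∷ bs) ≡ suc (des (b ∷ bs))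
des-front b bs b<a rewrite <ᵇ-true b<a = refl

des-∷ʳ : ∀ {a} b bs → All (_< a) (b ∷ bs) → des (b ∷ bs ∷ʳ a) ≡ des (b ∷ bs)
des-∷ʳ {a} b []       (b<a ∷ _)     rewrite <ᵇ-false {a} {b} (ℕₚ.<⇒≤ b<a) = refl
des-∷ʳ     b (c ∷ cs) (_ ∷ below) = cong (b2n (c <ᵇ b) ℕ.+_) (des-∷ʳ c cs below)

lhsMonomial : List ℕ → Monomial
lhsMonomial σ = (½ ^ minimaExcess σ , des σ)

lhsPoly : ℕ → Poly
lhsPoly m = map lhsMonomial (perms m)

map-as-concatMap : ∀ {A B : Set} (f : A → B) xs → map f xs ≡ concatMap ([_] ∘ f) xs
map-as-concatMap f xs = trans (sym (Listₚ.concatMap-pure (map f xs))) (Listₚ.concatMap-map [_] f xs)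

collect-monomials : ∀ w D A →
  (½ * w , suc D) ∷ (fromℕ D * w , D) ∷ (fromℕ A * w , suc D) ∷ (½ * w , D) ∷ [] ≈ insertMax (suc (D ℕ.+ A)) [ (w , D) ]
collect-monomials w D A = mk≈ coeff-eq
  where
  open ≡-Reasoning
  weight : ∀ c d i → coeffOf i (c * w , d) ≡ c * coeffOf i (w , d)
  weight c d i = coeffOf-weight (λ _ → c) i w d
  coeff-eq : ∀ i → coeff ((½ * w , suc D) ∷ (fromℕ D * w , D) ∷ (fromℕ A * w , suc D) ∷ (½ * w , D) ∷ []) i
                   ≡ coeff (insertMax (suc (D ℕ.+ A)) [ (w , D) ]) i
  coeff-eq i = begin
    coeffOf i (½ * w , suc D) + (coeffOf i (fromℕ D * w , D) + (coeffOf i (fromℕ A * w , suc D) + (coeffOf i (½ * w , D) + 0ℚ)))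
      ≡⟨ cong₂ _+_ (weight ½ (suc D) i) (cong₂ _+_ (weight (fromℕ D) D i) (cong₂ _+_ (weight (fromℕ A) (suc D) i)
                                                                                    (cong (_+ 0ℚ) (weight ½ D i)))) ⟩
    ½ * e′ + (fromℕ D * e + (fromℕ A * e′ + (½ * e + 0ℚ)))
      ≡⟨ solve 4 (λ d a e e′ → con ½ :* e′ :+ (d :* e :+ (a :* e′ :+ (con ½ :* e :+ con 0ℚ)))
                            := (d :+ con ½) :* e :+ (((con 1ℚ :+ (d :+ a)) :- (con 1ℚ :+ d) :+ con ½) :* e′ :+ con 0ℚ))
                 refl (fromℕ D) (fromℕ A) e e′ ⟩
    (fromℕ D + ½) * e + ((1ℚ + (fromℕ D + fromℕ A) - fromℕ (suc D) + ½) * e′ + 0ℚ)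
      ≡⟨ cong (λ n → (fromℕ D + ½) * e + ((1ℚ + n - fromℕ (suc D) + ½) * e′ + 0ℚ)) (fromℕ-+ D A) ⟨
    (fromℕ D + ½) * e + ((fromℕ (suc (D ℕ.+ A)) - fromℕ (suc D) + ½) * e′ + 0ℚ)
      ≡⟨ cong₂ (λ y z → y + (z + 0ℚ)) (weight (fromℕ D + ½) D i)
                                      (weight (fromℕ (suc (D ℕ.+ A)) - fromℕ (suc D) + ½) (suc D) i) ⟨
    coeff (insertMax (suc (D ℕ.+ A)) [ (w , D) ]) i ∎
    where
    e  = coeffOf i (w , D)
    e′ = coeffOf i (w , suc D)
lhs-insert : ∀ {a} b bs → All (_< a) (b ∷ bs) →
  map lhsMonomial (insertions a (b ∷ bs)) ≈ insertMax (length (b ∷ bs)) [ lhsMonomial (b ∷ bs) ]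
lhs-insert {a} b bs below@(b<a ∷ _) = begin
  map lhsMonomial (insertions a (b ∷ bs))
    ≡⟨ cong (lhsMonomial (a ∷ b ∷ bs) ∷_) split ⟩
  lhsMonomial (a ∷ b ∷ bs) ∷ (map (lhsMonomial ∘ (b ∷_)) τs ++ [ lhsMonomial (b ∷ bs ∷ʳ a) ])
    ≡⟨ cong (λ ys → lhsMonomial (a ∷ b ∷ bs) ∷ (ys ++ [ lhsMonomial (b ∷ bs ∷ʳ a) ])) middle ⟩
  lhsMonomial (a ∷ b ∷ bs) ∷ (concatMap (F ∘ stat) τs ++ [ lhsMonomial (b ∷ bs ∷ʳ a) ])
    ≡⟨ cong₂ (λ x z → x ∷ (concatMap (F ∘ stat) τs ++ [ z ])) front back ⟩
  (½ * w , suc D) ∷ (concatMap (F ∘ stat) τs ++ [ (½ * w , D) ])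
    ≈⟨ ++-congˡ [ (½ * w , suc D) ] (++-congʳ [ (½ * w , D) ] (concatMap-Flagged F (des-insertsBefore b bs below))) ⟩
  (½ * w , suc D) ∷ (fromℕ (trues gs) * w , D) ∷ (fromℕ (falses gs) * w , suc D) ∷ (½ * w , D) ∷ []
    ≡⟨ cong (λ t → (½ * w , suc D) ∷ (fromℕ t * w , D) ∷ (fromℕ (falses gs) * w , suc D) ∷ (½ * w , D) ∷ [])
            (trues-descentFlags b bs) ⟩
  (½ * w , suc D) ∷ (fromℕ D * w , D) ∷ (fromℕ (falses gs) * w , suc D) ∷ (½ * w , D) ∷ []
    ≈⟨ collect-monomials w D (falses gs) ⟩
  insertMax (suc (D ℕ.+ falses gs)) [ (w , D) ]
    ≡⟨ cong (λ n → insertMax (suc n) [ (w , D) ]) length≡ ⟩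
  insertMax (length (b ∷ bs)) [ lhsMonomial (b ∷ bs) ] ∎
  where
  open ≈-Reasoning
  τs = insertsBefore a bs
  gs = descentFlags b bs
  w  = ½ ^ minimaExcess (b ∷ bs)
  D  = des (b ∷ bs)
  stat : List ℕ → ℕ
  stat τ = des (b ∷ τ)
  F : ℕ → Poly
  F d = [ (w , d) ]
  split : map lhsMonomial (map (b ∷_) (insertions a bs)) ≡ map (lhsMonomial ∘ (b ∷_)) τs ++ [ lhsMonomial (b ∷ bs ∷ʳ a) ]
  split = trans (sym (Listₚ.map-∘ (insertions a bs)))
                (trans (cong (map (lhsMonomial ∘ (b ∷_))) (insertions-∷ʳ a bs)) (Listₚ.map-++ _ τs _))
  front : lhsMonomial (a ∷ b ∷ bs) ≡ (½ * w , suc D)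
  front = cong₂ _,_ (cong (½ ^_) (minimaExcess-front b bs below)) (des-front b bs b<a)
  back : lhsMonomial (b ∷ bs ∷ʳ a) ≡ (½ * w , D)
  back = cong₂ _,_ (cong (½ ^_) (minimaExcess-∷ʳ b bs below)) (des-∷ʳ b bs below)
  middle : map (lhsMonomial ∘ (b ∷_)) τs ≡ concatMap (F ∘ stat) τs
  middle = trans (Listₚ.map-cong-local (All.map (λ {τ} → cong (λ e → (½ ^ e , stat τ))) (minimaExcess-insertsBefore b bs below)))
                 (map-as-concatMap (λ τ → (w , stat τ)) τs)
  length≡ : D ℕ.+ falses gs ≡ length bs
  length≡ = trans (cong (ℕ._+ falses gs) (sym (trues-descentFlags b bs)))
                  (trans (trues+falses≡length gs) (length-descentFlags b bs))

lhs-step : ∀ m → lhsPoly (suc (suc m)) ≈ insertMax (suc m) (lhsPoly (suc m))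
lhs-step m = begin
  map lhsMonomial (concatMap (insertions (suc (suc m))) (perms (suc m)))
    ≡⟨ Listₚ.map-concatMap lhsMonomial _ (perms (suc m)) ⟩
  concatMap (map lhsMonomial ∘ insertions (suc (suc m))) (perms (suc m))
    ≈⟨ concatMap-cong-≈ (perms (suc m)) (All.zipWith insert-one (perms-length (suc m) , perms-below (suc m))) ⟩
  concatMap (λ σ → insertMax (suc m) [ lhsMonomial σ ]) (perms (suc m))
    ≡⟨ Listₚ.concatMap-map _ lhsMonomial (perms (suc m)) ⟨
  insertMax (suc m) (lhsPoly (suc m)) ∎
  where
  open ≈-Reasoning
  insert-one : ∀ {σ} → length σ ≡ suc m × All (_< suc (suc m)) σ →
    map lhsMonomial (insertions (suc (suc m)) σ) ≈ insertMax (suc m) [ lhsMonomial σ ]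
  insert-one {b ∷ bs} (len , below) =
    ≈-trans (lhs-insert b bs below) (≈-reflexive (cong (λ n → insertMax n [ lhsMonomial (b ∷ bs) ]) len))

peakAt : ℕ → ℕ → ℕ → Bool
peakAt p q c = (p <ᵇ q) ∧ (c <ᵇ q)

peakAtHead : ℕ → ℕ → List ℕ → Bool
peakAtHead p q []      = false
peakAtHead p q (c ∷ _) = peakAt p q c

peaks-∷ : ∀ p q t → peaks (p ∷ q ∷ t) ≡ b2n (peakAtHead p q t) ℕ.+ peaks (q ∷ t)
peaks-∷ p q []      = refl
peaks-∷ p q (c ∷ t) = refl

peaks-0∷ : ∀ τ → peaks (0 ∷ 0 ∷ τ) ≡ leftPeaks τ
peaks-0∷ []      = refl
peaks-0∷ (c ∷ τ) = refl

adjacent-peaks : ∀ p q c cs → peakAt p q c ∧ peakAtHead q c cs ≡ false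
adjacent-peaks p q c []      = ∧-zeroʳ (peakAt p q c)
adjacent-peaks p q c (d ∷ _) with c <ᵇ q in c<ᵇq
... | false rewrite ∧-zeroʳ (p <ᵇ q) = refl
... | true  rewrite <ᵇ-false {q} {c} (ℕₚ.<⇒≤ (ℕₚ.<ᵇ⇒< c q (subst T (sym c<ᵇq) _))) = ∧-zeroʳ _

b2n-∨ : ∀ x y → x ∧ y ≡ false → b2n (x ∨ y) ≡ b2n x ℕ.+ b2n y
b2n-∨ true  false _ = refl
b2n-∨ false y     _ = refl

-- Inserting a maximum just before c leaves the number of peaks unchanged exactly
-- when it destroys a peak at c or at its predecessor.
peakFlags : ℕ → ℕ → List ℕ → List Bool
peakFlags p q []       = []
peakFlags p q (c ∷ cs) = (peakAt p q c ∨ peakAtHead q c cs) ∷ peakFlags q c cs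

length-peakFlags : ∀ p q t → length (peakFlags p q t) ≡ length t
length-peakFlags p q []       = refl
length-peakFlags p q (c ∷ cs) = cong suc (length-peakFlags q c cs)

peaks-insertFront : ∀ {a} p q c cs → q < a → c < a → peaks (p ∷ q ∷ a ∷ c ∷ cs) ≡ suc (peaks (c ∷ cs))
peaks-insertFront {a} p q c cs q<a c<a
  rewrite <ᵇ-false {a} {q} (ℕₚ.<⇒≤ q<a) | ∧-zeroʳ (p <ᵇ q) | <ᵇ-true q<a | <ᵇ-true c<a =
  cong suc (trans (peaks-∷ a c cs) (cong (ℕ._+ peaks (c ∷ cs)) (not-peak cs)))
  where
  not-peak : ∀ cs → b2n (peakAtHead a c cs) ≡ 0
  not-peak []      = refl
  not-peak (_ ∷ _) rewrite <ᵇ-false {a} {c} (ℕₚ.<⇒≤ c<a) = refl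

peaks-insertsBefore : ∀ {a} p q t → q < a → All (_< a) t →
  Flagged (λ τ → peaks (p ∷ q ∷ τ)) (insertsBefore a t) (peaks (p ∷ q ∷ t)) (peakFlags p q t)
peaks-insertsBefore     p q []       _   _             = refl
peaks-insertsBefore {a} p q (c ∷ cs) q<a (c<a ∷ below) = cong₂ _∷_ front
  (trans (sym (Listₚ.map-∘ (insertsBefore a cs))) (raise-Flagged (b2n x) (peaks-insertsBefore q c cs c<a below)))
  where
  x = peakAt p q c
  y = peakAtHead q c cs
  front : peaks (p ∷ q ∷ a ∷ c ∷ cs) ≡ b2n (not (x ∨ y)) ℕ.+ peaks (p ∷ q ∷ c ∷ cs)
  front = begin
    peaks (p ∷ q ∷ a ∷ c ∷ cs)                                     ≡⟨ peaks-insertFront p q c cs q<a c<a ⟩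
    suc (peaks (c ∷ cs))                                           ≡⟨ b2n-not-+ (x ∨ y) _ ⟨
    b2n (not (x ∨ y)) ℕ.+ (b2n (x ∨ y) ℕ.+ peaks (c ∷ cs))
      ≡⟨ cong (λ n → b2n (not (x ∨ y)) ℕ.+ (n ℕ.+ peaks (c ∷ cs))) (b2n-∨ x y (adjacent-peaks p q c cs)) ⟩
    b2n (not (x ∨ y)) ℕ.+ (b2n x ℕ.+ b2n y ℕ.+ peaks (c ∷ cs))
      ≡⟨ cong (b2n (not (x ∨ y)) ℕ.+_) (trans (ℕₚ.+-assoc (b2n x) _ _) (cong (b2n x ℕ.+_) (sym (peaks-∷ q c cs)))) ⟩
    b2n (not (x ∨ y)) ℕ.+ peaks (p ∷ q ∷ c ∷ cs)                   ∎
    where open ≡-Reasoning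

-- Each peak is flagged twice, from the insertion slots on either side of it.
trues-peakFlags : ∀ p q t → trues (peakFlags p q t) ℕ.+ b2n (peakAtHead p q t) ≡ peaks (p ∷ q ∷ t) ℕ.+ peaks (p ∷ q ∷ t)
trues-peakFlags p q []       = refl
trues-peakFlags p q (c ∷ cs) = begin
  (b2n (x ∨ y) ℕ.+ t) ℕ.+ b2n x      ≡⟨ cong (λ n → (n ℕ.+ t) ℕ.+ b2n x) (b2n-∨ x y (adjacent-peaks p q c cs)) ⟩
  (b2n x ℕ.+ b2n y ℕ.+ t) ℕ.+ b2n x  ≡⟨ rearrange (b2n x) (b2n y) t ⟩
  (b2n x ℕ.+ b2n x) ℕ.+ (t ℕ.+ b2n y) ≡⟨ cong ((b2n x ℕ.+ b2n x) ℕ.+_) (trues-peakFlags q c cs) ⟩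
  (b2n x ℕ.+ b2n x) ℕ.+ (P ℕ.+ P)    ≡⟨ interchange (b2n x) P ⟩
  (b2n x ℕ.+ P) ℕ.+ (b2n x ℕ.+ P)    ∎
  where
  open ≡-Reasoning
  x = peakAt p q c
  y = peakAtHead q c cs
  t = trues (peakFlags q c cs)
  P = peaks (q ∷ c ∷ cs)
  rearrange : ∀ x y t → (x ℕ.+ y ℕ.+ t) ℕ.+ x ≡ (x ℕ.+ x) ℕ.+ (t ℕ.+ y)
  rearrange = solve-∀
  interchange : ∀ x p → (x ℕ.+ x) ℕ.+ (p ℕ.+ p) ≡ (x ℕ.+ p) ℕ.+ (x ℕ.+ p)
  interchange = solve-∀

peaks-∷ʳ : ∀ {a} w → All (_< a) w → peaks (w ∷ʳ a) ≡ peaks w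
peaks-∷ʳ         []              _                  = refl
peaks-∷ʳ         (p ∷ [])        _                  = refl
peaks-∷ʳ {a}     (p ∷ q ∷ [])    (_ ∷ q<a ∷ _)
  rewrite <ᵇ-false {a} {q} (ℕₚ.<⇒≤ q<a) | ∧-zeroʳ (p <ᵇ q) = refl
peaks-∷ʳ         (p ∷ q ∷ r ∷ t) (_ ∷ below)        = cong (b2n (peakAt p q r) ℕ.+_) (peaks-∷ʳ (q ∷ r ∷ t) below)

trues-leftPeakFlags : ∀ σ → trues (peakFlags 0 0 σ) ≡ leftPeaks σ ℕ.+ leftPeaks σ
trues-leftPeakFlags σ = begin
  trues (peakFlags 0 0 σ)                                ≡⟨ ℕₚ.+-identityʳ _ ⟨
  trues (peakFlags 0 0 σ) ℕ.+ 0                          ≡⟨ cong (trues (peakFlags 0 0 σ) ℕ.+_) (no-peak-at-0 σ) ⟨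
  trues (peakFlags 0 0 σ) ℕ.+ b2n (peakAtHead 0 0 σ)     ≡⟨ trues-peakFlags 0 0 σ ⟩
  peaks (0 ∷ 0 ∷ σ) ℕ.+ peaks (0 ∷ 0 ∷ σ)                ≡⟨ cong₂ ℕ._+_ (peaks-0∷ σ) (peaks-0∷ σ) ⟩
  leftPeaks σ ℕ.+ leftPeaks σ                            ∎
  where
  open ≡-Reasoning
  no-peak-at-0 : ∀ σ → b2n (peakAtHead 0 0 σ) ≡ 0
  no-peak-at-0 []      = refl
  no-peak-at-0 (_ ∷ _) = refl

length≡falses+2·leftPeaks : ∀ σ → length σ ≡ falses (peakFlags 0 0 σ) ℕ.+ (leftPeaks σ ℕ.+ leftPeaks σ)
length≡falses+2·leftPeaks σ = begin
  length σ                                            ≡⟨ length-peakFlags 0 0 σ ⟨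
  length (peakFlags 0 0 σ)                            ≡⟨ trues+falses≡length (peakFlags 0 0 σ) ⟨
  trues (peakFlags 0 0 σ) ℕ.+ falses (peakFlags 0 0 σ) ≡⟨ ℕₚ.+-comm (trues (peakFlags 0 0 σ)) _ ⟩
  falses (peakFlags 0 0 σ) ℕ.+ trues (peakFlags 0 0 σ) ≡⟨ cong (falses (peakFlags 0 0 σ) ℕ.+_) (trues-leftPeakFlags σ) ⟩
  falses (peakFlags 0 0 σ) ℕ.+ (leftPeaks σ ℕ.+ leftPeaks σ) ∎
  where open ≡-Reasoning

peakPoly : ℕ → ℕ → Poly
peakPoly n k = uxPow (n ∸ (k ℕ.+ k)) k

rhsPoly : ℕ → Poly
rhsPoly n = concatMap (peakPoly n ∘ leftPeaks) (perms n)

peakPoly-+ : ∀ j k → peakPoly (j ℕ.+ (k ℕ.+ k)) k ≡ uxPow j k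
peakPoly-+ j k = cong (λ n → uxPow n k) (ℕₚ.m+n∸n≡m j (k ℕ.+ k))

peakPoly-+-suc : ∀ j k → peakPoly (suc (j ℕ.+ (k ℕ.+ k))) (suc k) ≡ uxPow (pred j) (suc k)
peakPoly-+-suc j k = cong (λ n → uxPow n (suc k)) (begin
  (j ℕ.+ (k ℕ.+ k)) ∸ (k ℕ.+ suc k)        ≡⟨ cong ((j ℕ.+ (k ℕ.+ k)) ∸_) (ℕₚ.+-suc k k) ⟩
  (j ℕ.+ (k ℕ.+ k)) ∸ suc (k ℕ.+ k)        ≡⟨ ℕₚ.pred[m∸n]≡m∸[1+n] (j ℕ.+ (k ℕ.+ k)) (k ℕ.+ k) ⟨
  pred ((j ℕ.+ (k ℕ.+ k)) ∸ (k ℕ.+ k))     ≡⟨ cong pred (ℕₚ.m+n∸n≡m j (k ℕ.+ k)) ⟩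
  pred j                                   ∎)
  where open ≡-Reasoning

rhs-insert : ∀ m σ → length σ ≡ m → All (_< suc m) σ →
  concatMap (peakPoly (suc m) ∘ leftPeaks) (insertions (suc m) σ) ≈ insertMax (suc m) (peakPoly m (leftPeaks σ))
rhs-insert m σ len below = begin
  concatMap (F ∘ leftPeaks) (insertions (suc m) σ)
    ≡⟨ trans (cong (concatMap (F ∘ leftPeaks)) (insertions-∷ʳ (suc m) σ)) (Listₚ.concatMap-++ _ τs _) ⟩
  concatMap (F ∘ leftPeaks) τs ++ (F (leftPeaks (σ ∷ʳ suc m)) ++ [])
    ≡⟨ cong₂ _++_ (Listₚ.concatMap-cong (λ τ → cong F (sym (peaks-0∷ τ))) τs)
                  (trans (Listₚ.++-identityʳ _) (cong F (peaks-∷ʳ (0 ∷ σ) (ℕₚ.0<1+n ∷ below)))) ⟩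
  concatMap (F ∘ stat) τs ++ F k
    ≈⟨ ++-congʳ (F k) (concatMap-Flagged F (peaks-insertsBefore 0 0 σ ℕₚ.0<1+n below)) ⟩
  (scale t (F (stat σ)) ++ scale (fromℕ j) (F (suc (stat σ)))) ++ F k
    ≡⟨ cong (λ K → (scale t (F K) ++ scale (fromℕ j) (F (suc K))) ++ F k) (peaks-0∷ σ) ⟩
  (scale t (F k) ++ scale (fromℕ j) (F (suc k))) ++ F k
    ≈⟨ ++-comm _ (F k) ⟩
  F k ++ (scale t (F k) ++ scale (fromℕ j) (F (suc k)))
    ≡⟨ Listₚ.++-assoc (F k) _ _ ⟨
  (F k ++ scale t (F k)) ++ scale (fromℕ j) (F (suc k))
    ≈⟨ ++-congʳ (scale (fromℕ j) (F (suc k))) (scale-suc (trues gs) (F k)) ⟩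
  scale (fromℕ (suc (trues gs))) (F k) ++ scale (fromℕ j) (F (suc k))
    ≡⟨ cong₂ (λ n p → scale (fromℕ (suc n)) p ++ scale (fromℕ j) (F (suc k)))
             (trues-leftPeakFlags σ) (trans (cong (λ n → peakPoly (suc n) k) m≡) (peakPoly-+ (suc j) k)) ⟩
  scale (fromℕ (suc (k ℕ.+ k))) (uxPow (suc j) k) ++ scale (fromℕ j) (F (suc k))
    ≡⟨ cong (λ p → scale (fromℕ (suc (k ℕ.+ k))) (uxPow (suc j) k) ++ scale (fromℕ j) p)
            (trans (cong (λ n → peakPoly (suc n) (suc k)) m≡) (peakPoly-+-suc j k)) ⟩
  scale (fromℕ (suc (k ℕ.+ k))) (uxPow (suc j) k) ++ scale (fromℕ j) (uxPow (pred j) (suc k))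
    ≈⟨ insertMax-uxPow j k ⟨
  insertMax (suc (j ℕ.+ (k ℕ.+ k))) (uxPow j k)
    ≡⟨ cong₂ (λ n p → insertMax (suc n) p) (sym m≡) (trans (sym (peakPoly-+ j k)) (cong (λ n → peakPoly n k) (sym m≡))) ⟩
  insertMax (suc m) (peakPoly m k) ∎
  where
  open ≈-Reasoning
  F = peakPoly (suc m)
  τs = insertsBefore (suc m) σ
  gs = peakFlags 0 0 σ
  stat : List ℕ → ℕ
  stat τ = peaks (0 ∷ 0 ∷ τ)
  k = leftPeaks σ
  j = falses gs
  t = fromℕ (trues gs)
  m≡ : m ≡ j ℕ.+ (k ℕ.+ k)
  m≡ = trans (sym len) (length≡falses+2·leftPeaks σ)

rhs-step : ∀ m → rhsPoly (suc m) ≈ insertMax (suc m) (rhsPoly m)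
rhs-step m = begin
  concatMap G (concatMap (insertions (suc m)) (perms m))
    ≡⟨ MonadProperties.associative (perms m) (insertions (suc m)) G ⟨
  concatMap (concatMap G ∘ insertions (suc m)) (perms m)
    ≈⟨ concatMap-cong-≈ (perms m) (All.zipWith (λ (len , below) → rhs-insert m _ len below) (perms-length m , perms-below m)) ⟩
  concatMap (insertMax (suc m) ∘ peakPoly m ∘ leftPeaks) (perms m)
    ≡⟨ MonadProperties.associative (perms m) (peakPoly m ∘ leftPeaks) _ ⟩
  insertMax (suc m) (rhsPoly m) ∎
  where
  open ≈-Reasoning
  G = peakPoly (suc m) ∘ leftPeaks

lhsPoly≈rhsPoly : ∀ n → lhsPoly (suc n) ≈ rhsPoly n
lhsPoly≈rhsPoly zero    = ≈-refl
lhsPoly≈rhsPoly (suc n) = ≈-trans (lhs-step n) (≈-trans (insertMax-cong (suc n) (lhsPoly≈rhsPoly n)) (≈-sym (rhs-step n)))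

*-sumℚ : ∀ {A : Set} c (f : A → ℚ) xs → c * sumℚ (map f xs) ≡ sumℚ (map (λ a → c * f a) xs)
*-sumℚ c f []       = ℚₚ.*-zeroʳ c
*-sumℚ c f (a ∷ xs) = trans (ℚₚ.*-distribˡ-+ c (f a) _) (cong (c * f a +_) (*-sumℚ c f xs))

^-+ : ∀ q a b → q ^ (a ℕ.+ b) ≡ q ^ a * q ^ b
^-+ q zero    b = sym (ℚₚ.*-identityˡ _)
^-+ q (suc a) b = trans (cong (q *_) (^-+ q a b)) (sym (ℚₚ.*-assoc q _ _))

^-*-square : ∀ r v k → r ^ k * v ^ (k ℕ.+ k) ≡ (r * (v * v)) ^ k
^-*-square r v zero    = ℚₚ.*-identityˡ 1ℚ
^-*-square r v (suc k) = begin
  r * r ^ k * (v * v ^ (k ℕ.+ suc k))           ≡⟨ cong (λ n → r * r ^ k * (v * v ^ n)) (ℕₚ.+-suc k k) ⟩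
  r * r ^ k * (v * (v * v ^ (k ℕ.+ k)))
    ≡⟨ solve 4 (λ r R v V → r :* R :* (v :* (v :* V)) := r :* (v :* v) :* (R :* V)) refl r (r ^ k) v (v ^ (k ℕ.+ k)) ⟩
  r * (v * v) * (r ^ k * v ^ (k ℕ.+ k))         ≡⟨ cong (r * (v * v) *_) (^-*-square r v k) ⟩
  r * (v * v) * (r * (v * v)) ^ k               ∎
  where open ≡-Reasoning

ratio*u² : ∀ x (h : 1ℚ + x ≢ 0ℚ) → ratio x h * (u x * u x) ≡ x
ratio*u² x h = begin
  ratio x h * (u x * u x)
    ≡⟨ solve 3 (λ x y y⁻¹ → (con 4ℚ :* x :* y⁻¹) :* y⁻¹ :* ((y :* con ½) :* (y :* con ½))
                          := x :* (y :* y⁻¹) :* (y :* y⁻¹))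
               refl x (1ℚ + x) (1/ (1ℚ + x)) ⟩
  x * ((1ℚ + x) * 1/ (1ℚ + x)) * ((1ℚ + x) * 1/ (1ℚ + x))  ≡⟨ cong (λ z → x * z * z) (ℚₚ.*-inverseʳ (1ℚ + x)) ⟩
  x * 1ℚ * 1ℚ                                              ≡⟨ trans (ℚₚ.*-identityʳ _) (ℚₚ.*-identityʳ x) ⟩
  x                                                        ∎
  where
  open ≡-Reasoning
  instance _ = ≢-nonZero h

eval-peakPoly : ∀ x h n k → k ℕ.+ k ≤ n → u x ^ n * ratio x h ^ k ≡ eval (peakPoly n k) x
eval-peakPoly x h n k 2k≤n = begin
  u x ^ n * ratio x h ^ k                       ≡⟨ cong (λ m → u x ^ m * ratio x h ^ k) (ℕₚ.m∸n+n≡m 2k≤n) ⟨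
  u x ^ (j ℕ.+ (k ℕ.+ k)) * ratio x h ^ k       ≡⟨ cong (_* ratio x h ^ k) (^-+ (u x) j (k ℕ.+ k)) ⟩
  u x ^ j * u x ^ (k ℕ.+ k) * ratio x h ^ k
    ≡⟨ solve 3 (λ A B R → A :* B :* R := A :* (R :* B)) refl (u x ^ j) (u x ^ (k ℕ.+ k)) (ratio x h ^ k) ⟩
  u x ^ j * (ratio x h ^ k * u x ^ (k ℕ.+ k))   ≡⟨ cong (u x ^ j *_) (^-*-square (ratio x h) (u x) k) ⟩
  u x ^ j * (ratio x h * (u x * u x)) ^ k       ≡⟨ cong (λ y → u x ^ j * y ^ k) (ratio*u² x h) ⟩
  u x ^ j * x ^ k                               ≡⟨ eval-uxPow j k x ⟨
  eval (uxPow j k) x                            ∎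
  where
  open ≡-Reasoning
  j = n ∸ (k ℕ.+ k)

2·leftPeaks≤length : ∀ σ → leftPeaks σ ℕ.+ leftPeaks σ ≤ length σ
2·leftPeaks≤length σ =
  subst (leftPeaks σ ℕ.+ leftPeaks σ ≤_) (sym (length≡falses+2·leftPeaks σ)) (ℕₚ.m≤n+m _ (falses (peakFlags 0 0 σ)))

lhs-eval : ∀ n x → lhs n x ≡ eval (lhsPoly (suc n)) x
lhs-eval n x = cong sumℚ (Listₚ.map-∘ (perms (suc n)))

rhs-eval : ∀ n x h → rhs n x h ≡ eval (rhsPoly n) x
rhs-eval n x h = begin
  u x ^ n * sumℚ (map (λ σ → ratio x h ^ leftPeaks σ) (perms n))
    ≡⟨ *-sumℚ (u x ^ n) _ (perms n) ⟩
  sumℚ (map (λ σ → u x ^ n * ratio x h ^ leftPeaks σ) (perms n))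
    ≡⟨ cong sumℚ (Listₚ.map-cong-local (All.map (λ {σ} → term σ) (perms-length n))) ⟩
  sumℚ (map (λ σ → eval (peakPoly n (leftPeaks σ)) x) (perms n))
    ≡⟨ eval-concatMap (peakPoly n ∘ leftPeaks) (perms n) x ⟨
  eval (rhsPoly n) x ∎
  where
  open ≡-Reasoning
  term : ∀ σ → length σ ≡ n → u x ^ n * ratio x h ^ leftPeaks σ ≡ eval (peakPoly n (leftPeaks σ)) x
  term σ len = eval-peakPoly x h n (leftPeaks σ) (subst (leftPeaks σ ℕ.+ leftPeaks σ ≤_) len (2·leftPeaks≤length σ))

mainTheorem12 : (n : ℕ) → n ≥ 1 → (x : ℚ) → (h : (1ℚ + x) ≢ 0ℚ) → lhs n x ≡ rhs n x h
mainTheorem12 n _ x h = begin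
  lhs n x                      ≡⟨ lhs-eval n x ⟩
  eval (lhsPoly (suc n)) x     ≡⟨ eval-cong (lhsPoly≈rhsPoly n) x ⟩
  eval (rhsPoly n) x           ≡⟨ rhs-eval n x h ⟨
  rhs n x h                    ∎
  where open ≡-Reasoning
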